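{- Let $\mathcal{A}=(a_i)_{i=1}^\infty$ be a weakly increasing sequence of positive integers and let $u,v$ be positive real numbers with $u>v$. If $k\geqslant2$ and $\gcd(a_1,a_2,\ldots,a_k)=1$, then $$p_\mathcal{A}^2(un,k)>p_\mathcal{A}(un+vn,k)\,p_\mathcal{A}(un-vn,k)$$ holds for every real number $n>\frac{4u}{kv^2}\prod_{i=1}^k(1+iDk)$ such that $un$, $un+vn$ and $un-vn$ are integers, where $D=\mathrm{lcm}(a_1,a_2,\ldots,a_k)$.
   Context: For a weakly increasing sequence $\mathcal{A}=(a_i)_{i\ge1}$ of positive integers and a positive integer $k$, $p_\mathcal{A}(n,k)$ is defined for integers $n$ by $\sum_{n\ge0}p_\mathcal{A}(n,k)x^n=\prod_{i=1}^k\frac{1}{1-x^{a_i}}$ (the number of partitions of $n$ into parts from the multiset $\{a_1,\dots,a_k\}$, equal values with different indices counting as different parts); $p_\mathcal{A}(n,k)=0$ for $n<0$. -}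

module Defs where

open import Data.Nat using (ℕ; zero; suc; _+_; _*_; _∸_; _≤_; _≤ᵇ_)
open import Data.Nat.GCD using (gcd)
open import Data.Nat.LCM using (lcm)
open import Data.Bool using (if_then_else_)
open import Data.List using (List; []; _∷_; map; foldr; upTo)
open import Data.Nat.ListAction using (sum; product)

-- A sequence 𝒜 = (a_i)_{i≥1} is represented 0-based: a : ℕ → ℕ with
-- paper's a_i  =  a (i ∸ 1), i.e. a 0 = a_1, a 1 = a_2, ...

firstTerms : (ℕ → ℕ) → ℕ → List ℕ
firstTerms a k = map a (upTo k)

-- p_𝒜(n,k): coefficient of x^n in ∏_{i=1}^k 1/(1 - x^{a_i}),
-- computed by expanding the last factor 1/(1-x^{a_k}) = Σ_j x^{j a_k}:
--   p(n,0)   = [n = 0]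
--   p(n,k+1) = Σ_{j ≥ 0, j a_{k+1} ≤ n} p(n - j a_{k+1}, k)
pA : (ℕ → ℕ) → ℕ → ℕ → ℕ
pA a zero    zero    = 1
pA a zero    (suc n) = 0
pA a (suc k) n =
  sum (map (λ j → if (j * a k) ≤ᵇ n then pA a k (n ∸ j * a k) else 0)
           (upTo (suc n)))

gcdFirst : (ℕ → ℕ) → ℕ → ℕ
gcdFirst a k = foldr gcd 0 (firstTerms a k)

lcmFirst : (ℕ → ℕ) → ℕ → ℕ
lcmFirst a k = foldr lcm 1 (firstTerms a k)

boundProd : ℕ → ℕ → ℕ
boundProd D k = product (map (λ i → 1 + suc i * D * k) (upTo k))

{-# OPTIONS --safe #-}
-- Each 1/(1 − x^{a_i}) is a polynomial with nonnegative
-- coefficients over 1 − x^D, so the window sums p(n) + p(n − 1) + ⋯ + p(n − D + 1)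
-- of p = p_𝒜(·,k) are squeezed between c·C(q + k − 1, k − 1) for integers q within
-- k of n/D. When gcd(a₁,…,a_k) = 1 every y ≥ kD² is a sum of parts, so
-- p(n) ≤ p(n + y), and D·p(n) itself is squeezed between such binomials with
-- q ≈ n/D ± O(kD). For n = m + d, m − d and m this yields indices Q₊, Q₋ and f with
-- (Q₊ + j)(Q₋ + j) < (f + j)² for all j < k as soon as (d/D)² is a large multiple
-- of kD·m/D, which is what the hypothesis on n provides; multiplying over j gives
-- p(m + d)·p(m − d) < p(m)².
module Submission where

open import Data.Bool using (true; false; if_then_else_; T)
open import Data.Empty using (⊥-elim)
open import Data.List using ([]; _∷_; map; foldr; applyUpTo)
open import Data.Nat
open import Data.Nat.Properties
open import Data.Nat.Divisibility using (_∣_; divides; ∣-trans; ∣⇒≤; 0∣⇒≡0; 1∣_; ∣m+n∣m⇒∣n)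
open import Data.Nat.DivMod using (_/_; _%_; m≡m%n+[m/n]*n; m%n<n)
open import Data.Nat.GCD using (gcd; gcd-GCD; gcd[m,n]∣m; gcd[m,n]∣n; gcd-identityʳ; module Bézout)
open import Data.Nat.LCM using (lcm; m∣lcm[m,n]; n∣lcm[m,n]; gcd*lcm)
open import Data.Nat.Induction using (<-rec)
open import Data.Nat.ListAction using (sum; product)
open import Data.Product using (∃; _×_; _,_; proj₁; proj₂)
open import Data.Sum using (inj₁; inj₂)
open import Data.Unit using (tt)
open import Function using (_∘_; id)
open import Relation.Nullary using (Dec; yes; no)
open import Relation.Binary.PropositionalEquality
open import Data.Nat.Tactic.RingSolver using (solve-∀)

open import Defs

-- Operators on coefficient sequences

-- shift f n t is the coefficient of xⁿ in xᵗ·f(x).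
shift : (ℕ → ℕ) → ℕ → ℕ → ℕ
shift f n t = if t ≤ᵇ n then f (n ∸ t) else 0

shift-≤ : ∀ f {n t} → t ≤ n → shift f n t ≡ f (n ∸ t)
shift-≤ f {n} {t} t≤n with t ≤ᵇ n | ≤⇒≤ᵇ t≤n
... | true | _ = refl

shift-> : ∀ f {n t} → n < t → shift f n t ≡ 0
shift-> f {n} {t} n<t with t ≤ᵇ n in eq
... | false = refl
... | true  = ⊥-elim (<⇒≱ n<t (≤ᵇ⇒≤ t n (subst T (sym eq) tt)))

shift-+ : ∀ f {n} s t → s ≤ n → shift f n (s + t) ≡ shift f (n ∸ s) t
shift-+ f {n} s t s≤n with t ≤? n ∸ s
... | yes t≤n∸s = begin
  shift f n (s + t)  ≡⟨ shift-≤ f (subst (s + t ≤_) (m+[n∸m]≡n s≤n) (+-monoʳ-≤ s t≤n∸s)) ⟩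
  f (n ∸ (s + t))    ≡⟨ cong f (sym (∸-+-assoc n s t)) ⟩
  f (n ∸ s ∸ t)      ≡⟨ sym (shift-≤ f t≤n∸s) ⟩
  shift f (n ∸ s) t  ∎
  where open ≡-Reasoning
... | no t≰n∸s = trans (shift-> f n<s+t) (sym (shift-> f (≰⇒> t≰n∸s)))
  where
  n<s+t : n < s + t
  n<s+t = ≰⇒> (t≰n∸s ∘ m+n≤o⇒m≤o∸n t ∘ subst (_≤ n) (+-comm s t))

shift-0 : ∀ f n → shift f n 0 ≡ f n
shift-0 f n = shift-≤ f z≤n

Σ< : (ℕ → ℕ) → ℕ → ℕ
Σ< g zero    = 0
Σ< g (suc n) = g 0 + Σ< (g ∘ suc) n

sum-map-applyUpTo : ∀ (g f : ℕ → ℕ) n → sum (map g (applyUpTo f n)) ≡ Σ< (g ∘ f) n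
sum-map-applyUpTo g f zero    = refl
sum-map-applyUpTo g f (suc n) = cong (g (f 0) +_) (sum-map-applyUpTo g (f ∘ suc) n)

Σ<-cong : ∀ {g h} n → (∀ r → r < n → g r ≡ h r) → Σ< g n ≡ Σ< h n
Σ<-cong zero    e = refl
Σ<-cong (suc n) e = cong₂ _+_ (e 0 z<s) (Σ<-cong n (λ r r<n → e (suc r) (s<s r<n)))

Σ<-zero : ∀ g n → (∀ r → r < n → g r ≡ 0) → Σ< g n ≡ 0
Σ<-zero g zero    e = refl
Σ<-zero g (suc n) e = cong₂ _+_ (e 0 z<s) (Σ<-zero (g ∘ suc) n (λ r r<n → e (suc r) (s<s r<n)))

Σ<-truncate : ∀ g {L M} → L ≤ M → (∀ r → L ≤ r → g r ≡ 0) → Σ< g M ≡ Σ< g L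
Σ<-truncate g {zero}  {M}     _         e = Σ<-zero g M (λ r _ → e r z≤n)
Σ<-truncate g {suc L} {suc M} (s≤s L≤M) e =
  cong (g 0 +_) (Σ<-truncate (g ∘ suc) L≤M (λ r L≤r → e (suc r) (s≤s L≤r)))

Σ<-snoc : ∀ g n → Σ< g (suc n) ≡ Σ< g n + g n
Σ<-snoc g zero    = +-comm (g 0) 0
Σ<-snoc g (suc n) = trans (cong (g 0 +_) (Σ<-snoc (g ∘ suc) n)) (sym (+-assoc (g 0) _ _))

Σ<-+ : ∀ g h n → Σ< (λ r → g r + h r) n ≡ Σ< g n + Σ< h n
Σ<-+ g h zero    = refl
Σ<-+ g h (suc n) = begin
  g 0 + h 0 + Σ< (λ r → g (suc r) + h (suc r)) n  ≡⟨ cong (g 0 + h 0 +_) (Σ<-+ (g ∘ suc) (h ∘ suc) n) ⟩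
  g 0 + h 0 + (Σ< (g ∘ suc) n + Σ< (h ∘ suc) n)   ≡⟨ +-assoc-swap (g 0) (h 0) _ _ ⟩
  g 0 + Σ< (g ∘ suc) n + (h 0 + Σ< (h ∘ suc) n)   ∎
  where
  open ≡-Reasoning
  +-assoc-swap : ∀ w x y z → w + x + (y + z) ≡ w + y + (x + z)
  +-assoc-swap = solve-∀

*-distribˡ-Σ< : ∀ c g n → c * Σ< g n ≡ Σ< (λ r → c * g r) n
*-distribˡ-Σ< c g zero    = *-zeroʳ c
*-distribˡ-Σ< c g (suc n) = trans (*-distribˡ-+ c (g 0) _) (cong (c * g 0 +_) (*-distribˡ-Σ< c (g ∘ suc) n))

Σ<-≤ : ∀ g n c → (∀ r → r < n → g r ≤ c) → Σ< g n ≤ n * c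
Σ<-≤ g zero    c h = z≤n
Σ<-≤ g (suc n) c h = +-mono-≤ (h 0 z<s) (Σ<-≤ (g ∘ suc) n c (λ r r<n → h (suc r) (s<s r<n)))

Σ<-≥ : ∀ g n c → (∀ r → r < n → c ≤ g r) → n * c ≤ Σ< g n
Σ<-≥ g zero    c h = z≤n
Σ<-≥ g (suc n) c h = +-mono-≤ (h 0 z<s) (Σ<-≥ (g ∘ suc) n c (λ r r<n → h (suc r) (s<s r<n)))

-- geomSum a f n is the coefficient of xⁿ in f(x)/(1 − xᵃ), so that
-- pA a (suc k) is geomSum (a k) (pA a k) by definition.
geomSum : ℕ → (ℕ → ℕ) → ℕ → ℕ
geomSum a f n = sum (map (λ j → shift f n (j * a)) (applyUpTo id (suc n)))

geomSum-step : ∀ a f n → 1 ≤ a → geomSum a f n ≡ f n + shift (geomSum a f) n a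
geomSum-step a f n 1≤a = begin
  geomSum a f n                                              ≡⟨ sum-map-applyUpTo _ id (suc n) ⟩
  shift f n 0 + Σ< (λ j → shift f n (a + j * a)) n           ≡⟨ cong₂ _+_ (shift-0 f n) (tail (a ≤? n)) ⟩
  f n + shift (geomSum a f) n a                              ∎
  where
  open ≡-Reasoning
  tail : Dec (a ≤ n) → Σ< (λ j → shift f n (a + j * a)) n ≡ shift (geomSum a f) n a
  tail (yes a≤n) = begin
    Σ< (λ j → shift f n (a + j * a)) n              ≡⟨ Σ<-cong n (λ j _ → shift-+ f a (j * a) a≤n) ⟩
    Σ< (λ j → shift f (n ∸ a) (j * a)) n            ≡⟨ Σ<-truncate _ n∸a<n vanish ⟩
    Σ< (λ j → shift f (n ∸ a) (j * a)) (suc (n ∸ a)) ≡⟨ sym (sum-map-applyUpTo _ id (suc (n ∸ a))) ⟩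
    geomSum a f (n ∸ a)                             ≡⟨ sym (shift-≤ (geomSum a f) a≤n) ⟩
    shift (geomSum a f) n a                         ∎
    where
    n∸a<n : n ∸ a < n
    n∸a<n = ∸-monoʳ-< 1≤a a≤n
    vanish : ∀ j → n ∸ a < j → shift f (n ∸ a) (j * a) ≡ 0
    vanish j n∸a<j = shift-> f (<-≤-trans n∸a<j (m≤m*n j a ⦃ >-nonZero 1≤a ⦄))
  tail (no a≰n) = trans (Σ<-zero _ n (λ j _ → shift-> f (<-≤-trans (≰⇒> a≰n) (m≤m+n a (j * a)))))
                        (sym (shift-> (geomSum a f) (≰⇒> a≰n)))

geomSum-unique : ∀ a g H → 1 ≤ a → (∀ n → H n ≡ g n + shift H n a) → ∀ n → H n ≡ geomSum a g n
geomSum-unique a g H 1≤a H-step = <-rec _ step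
  where
  step : ∀ n → (∀ {m} → m < n → H m ≡ geomSum a g m) → H n ≡ geomSum a g n
  step n ih = begin
    H n                              ≡⟨ H-step n ⟩
    g n + shift H n a                ≡⟨ cong (g n +_) (shifted (a ≤? n)) ⟩
    g n + shift (geomSum a g) n a    ≡⟨ sym (geomSum-step a g n 1≤a) ⟩
    geomSum a g n                    ∎
    where
    open ≡-Reasoning
    shifted : Dec (a ≤ n) → shift H n a ≡ shift (geomSum a g) n a
    shifted (yes a≤n) = trans (shift-≤ H a≤n)
      (trans (ih (∸-monoʳ-< 1≤a a≤n)) (sym (shift-≤ (geomSum a g) a≤n)))
    shifted (no a≰n)  = trans (shift-> H (≰⇒> a≰n)) (sym (shift-> (geomSum a g) (≰⇒> a≰n)))

shift-geomSum : ∀ a f n t → 1 ≤ a →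
  shift (geomSum a f) n t ≡ shift f n t + shift (geomSum a f) n (t + a)
shift-geomSum a f n t 1≤a with t ≤? n
... | yes t≤n = begin
  shift (geomSum a f) n t                            ≡⟨ shift-≤ (geomSum a f) t≤n ⟩
  geomSum a f (n ∸ t)                                ≡⟨ geomSum-step a f (n ∸ t) 1≤a ⟩
  f (n ∸ t) + shift (geomSum a f) (n ∸ t) a          ≡⟨ cong₂ _+_ (sym (shift-≤ f t≤n)) (sym (shift-+ (geomSum a f) t a t≤n)) ⟩
  shift f n t + shift (geomSum a f) n (t + a)        ∎
  where open ≡-Reasoning
... | no t≰n = trans (shift-> (geomSum a f) (≰⇒> t≰n))
  (sym (cong₂ _+_ (shift-> f (≰⇒> t≰n)) (shift-> (geomSum a f) (<-≤-trans (≰⇒> t≰n) (m≤m+n t a)))))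

shift-Σ< : ∀ (g h : ℕ → ℕ) b n a →
  shift (λ y → Σ< (λ r → shift g y (h r)) b) n a ≡ Σ< (λ r → shift g n (a + h r)) b
shift-Σ< g h b n a with a ≤? n
... | yes a≤n = trans (shift-≤ (λ y → Σ< (λ r → shift g y (h r)) b) a≤n) (Σ<-cong b (λ r _ → sym (shift-+ g a (h r) a≤n)))
... | no a≰n = trans (shift-> (λ y → Σ< (λ r → shift g y (h r)) b) (≰⇒> a≰n))
  (sym (Σ<-zero _ b (λ r _ → shift-> g (<-≤-trans (≰⇒> a≰n) (m≤m+n a (h r))))))

-- window D f n is the coefficient of xⁿ in (1 + x + ⋯ + x^(D−1))·f(x).
window : ℕ → (ℕ → ℕ) → ℕ → ℕ
window D f n = Σ< (shift f n) D

window-geomSum : ∀ D a f → 1 ≤ a → ∀ n → window D (geomSum a f) n ≡ geomSum a (window D f) n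
window-geomSum D a f 1≤a = geomSum-unique a (window D f) (window D (geomSum a f)) 1≤a step
  where
  step : ∀ n → window D (geomSum a f) n ≡ window D f n + shift (window D (geomSum a f)) n a
  step n = begin
    Σ< (shift (geomSum a f) n) D                                 ≡⟨ Σ<-cong D (λ t _ → shift-geomSum a f n t 1≤a) ⟩
    Σ< (λ t → shift f n t + shift (geomSum a f) n (t + a)) D     ≡⟨ Σ<-+ _ _ D ⟩
    window D f n + Σ< (λ t → shift (geomSum a f) n (t + a)) D    ≡⟨ cong (window D f n +_) (Σ<-cong D (λ t _ → cong (shift (geomSum a f) n) (+-comm t a))) ⟩
    window D f n + Σ< (λ t → shift (geomSum a f) n (a + t)) D    ≡⟨ cong (window D f n +_) (sym (shift-Σ< (geomSum a f) id D n a)) ⟩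
    window D f n + shift (window D (geomSum a f)) n a            ∎
    where open ≡-Reasoning

-- 1/(1 − xᵃ) = (1 + xᵃ + ⋯ + x^((b−1)a)) / (1 − x^(ba)).
geomSum-split : ∀ a b f → 1 ≤ a → 1 ≤ b → ∀ n →
  geomSum a f n ≡ Σ< (λ r → shift (geomSum (b * a) f) n (r * a)) b
geomSum-split a (suc b) f 1≤a _ n = sym (geomSum-unique a f G 1≤a step n)
  where
  TD = geomSum (suc b * a) f
  G : ℕ → ℕ
  G y = Σ< (λ r → shift TD y (r * a)) (suc b)
  step : ∀ y → G y ≡ f y + shift G y a
  step y = begin
    shift TD y 0 + X                                ≡⟨ cong (_+ X) (shift-0 TD y) ⟩
    TD y + X                                        ≡⟨ cong (_+ X) (geomSum-step (suc b * a) f y (≤-trans 1≤a (m≤m+n a (b * a)))) ⟩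
    f y + shift TD y (suc b * a) + X                ≡⟨ +-assoc (f y) _ X ⟩
    f y + (shift TD y (suc b * a) + X)              ≡⟨ cong (f y +_) (+-comm _ X) ⟩
    f y + (X + shift TD y (suc b * a))              ≡⟨ cong (f y +_) (sym (Σ<-snoc (λ r → shift TD y (suc r * a)) b)) ⟩
    f y + Σ< (λ r → shift TD y (a + r * a)) (suc b) ≡⟨ cong (f y +_) (sym (shift-Σ< TD (_* a) (suc b) y a)) ⟩
    f y + shift G y a                               ∎
    where
    open ≡-Reasoning
    X = Σ< (λ r → shift TD y (suc r * a)) b

-- Polynomial growth of the window sums

-- rising k q = (q + 1)(q + 2)⋯(q + k) = k!·C(q + k, k).
rising : ℕ → ℕ → ℕ
rising zero    q = 1
rising (suc k) q = rising k q * (q + suc k)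

rising-pos : ∀ k q → 1 ≤ rising k q
rising-pos zero    q = ≤-refl
rising-pos (suc k) q = *-mono-≤ (rising-pos k q) (≤-trans (s≤s z≤n) (m≤n+m (suc k) q))

rising-shift : ∀ k Q → rising (suc k) Q ≡ suc Q * rising k (suc Q)
rising-shift zero    Q = identity Q
  where
  identity : ∀ Q → 1 * (Q + 1) ≡ suc Q * 1
  identity = solve-∀
rising-shift (suc k) Q = trans (cong (_* (Q + suc (suc k))) (rising-shift k Q)) (identity Q k (rising k (suc Q)))
  where
  identity : ∀ Q k X → suc Q * X * (Q + suc (suc k)) ≡ suc Q * (X * (suc Q + suc k))
  identity = solve-∀

rising-pascal : ∀ k Q → rising (suc k) (suc Q) ≡ rising (suc k) Q + suc k * rising k (suc Q)
rising-pascal k Q =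
  trans (identity Q k (rising k (suc Q))) (cong (_+ suc k * rising k (suc Q)) (sym (rising-shift k Q)))
  where
  identity : ∀ Q k X → X * (suc Q + suc k) ≡ suc Q * X + suc k * X
  identity = solve-∀

rising-suc-* : ∀ k Q₁ Q₂ →
  rising (suc k) Q₁ * rising (suc k) Q₂ ≡ rising k Q₁ * rising k Q₂ * ((Q₁ + suc k) * (Q₂ + suc k))
rising-suc-* k Q₁ Q₂ = identity (rising k Q₁) (rising k Q₂) (Q₁ + suc k) (Q₂ + suc k)
  where
  identity : ∀ a b x y → a * x * (b * y) ≡ a * b * (x * y)
  identity = solve-∀

rising-*-≤ : ∀ k q Q₁ Q₂ → (∀ j → 1 ≤ j → j ≤ k → (Q₁ + j) * (Q₂ + j) < (q + j) * (q + j)) →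
  rising k Q₁ * rising k Q₂ ≤ rising k q * rising k q
rising-*-≤ zero    q Q₁ Q₂ h = ≤-refl
rising-*-≤ (suc k) q Q₁ Q₂ h = begin
  rising (suc k) Q₁ * rising (suc k) Q₂                         ≡⟨ rising-suc-* k Q₁ Q₂ ⟩
  rising k Q₁ * rising k Q₂ * ((Q₁ + suc k) * (Q₂ + suc k))      ≤⟨ *-mono-≤ (rising-*-≤ k q Q₁ Q₂ (λ j 1≤j j≤k → h j 1≤j (m≤n⇒m≤1+n j≤k))) (<⇒≤ (h (suc k) (s≤s z≤n) ≤-refl)) ⟩
  rising k q * rising k q * ((q + suc k) * (q + suc k))         ≡⟨ sym (rising-suc-* k q q) ⟩
  rising (suc k) q * rising (suc k) q                           ∎
  where open ≤-Reasoning

rising-*-< : ∀ k q Q₁ Q₂ → (∀ j → 1 ≤ j → j ≤ suc k → (Q₁ + j) * (Q₂ + j) < (q + j) * (q + j)) →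
  rising (suc k) Q₁ * rising (suc k) Q₂ < rising (suc k) q * rising (suc k) q
rising-*-< k q Q₁ Q₂ h = begin-strict
  rising (suc k) Q₁ * rising (suc k) Q₂                         ≡⟨ rising-suc-* k Q₁ Q₂ ⟩
  rising k Q₁ * rising k Q₂ * ((Q₁ + suc k) * (Q₂ + suc k))      ≤⟨ *-monoˡ-≤ _ (rising-*-≤ k q Q₁ Q₂ (λ j 1≤j j≤k → h j 1≤j (m≤n⇒m≤1+n j≤k))) ⟩
  rising k q * rising k q * ((Q₁ + suc k) * (Q₂ + suc k))       <⟨ *-monoʳ-< _ ⦃ >-nonZero (*-mono-≤ (rising-pos k q) (rising-pos k q)) ⦄ (h (suc k) (s≤s z≤n) ≤-refl) ⟩
  rising k q * rising k q * ((q + suc k) * (q + suc k))         ≡⟨ sym (rising-suc-* k q q) ⟩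
  rising (suc k) q * rising (suc k) q                           ∎
  where open ≤-Reasoning

-- g x grows like (scale / k!)·rising k (x/D); the lower estimate lags by L steps.
record Sandwich (k L D : ℕ) (g : ℕ → ℕ) : Set where
  field
    scale     : ℕ
    scale-pos : 1 ≤ scale
    upper     : ∀ Q x → x < suc Q * D → k ! * g x ≤ scale * rising k Q
    lower     : ∀ q x → (q + L) * D ≤ x → scale * rising k q ≤ k ! * g x

!-suc-distrib : ∀ k y z → suc k ! * (y + z) ≡ suc k * (k ! * y) + suc k ! * z
!-suc-distrib k = identity (suc k) (k !)
  where
  identity : ∀ s F y z → s * F * (y + z) ≡ s * (F * y) + s * F * z
  identity = solve-∀

*-rising-pascal : ∀ c k Q → c * rising (suc k) (suc Q) ≡ suc k * (c * rising k (suc Q)) + c * rising (suc k) Q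
*-rising-pascal c k Q = trans (cong (c *_) (rising-pascal k Q)) (identity c (suc k) (rising k (suc Q)) (rising (suc k) Q))
  where
  identity : ∀ c s X Y → c * (Y + s * X) ≡ s * (c * X) + c * Y
  identity = solve-∀

*-rising-0 : ∀ c k → c * rising (suc k) 0 ≡ suc k * (c * rising k 0) + 0
*-rising-0 c k = identity c (suc k) (rising k 0)
  where
  identity : ∀ c s X → c * (X * s) ≡ s * (c * X) + 0
  identity = solve-∀

module _ {k L D : ℕ} {w : ℕ → ℕ} (1≤D : 1 ≤ D) (bounds : Sandwich k L D w) where

  open Sandwich bounds

  private
    G = geomSum D w

    G-split : ∀ x → suc k ! * G x ≡ suc k * (k ! * w x) + suc k ! * shift G x D
    G-split x = trans (cong (suc k ! *_) (geomSum-step D w x 1≤D)) (!-suc-distrib k (w x) (shift G x D))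

  geomSum-upper : ∀ Q x → x < suc Q * D → suc k ! * G x ≤ scale * rising (suc k) Q
  geomSum-upper zero x x<D = begin
    suc k ! * G x                                          ≡⟨ G-split x ⟩
    suc k * (k ! * w x) + suc k ! * shift G x D            ≡⟨ cong (λ z → suc k * (k ! * w x) + suc k ! * z) (shift-> G (subst (x <_) (+-identityʳ D) x<D)) ⟩
    suc k * (k ! * w x) + suc k ! * 0                      ≤⟨ +-monoˡ-≤ _ (*-monoʳ-≤ (suc k) (upper zero x x<D)) ⟩
    suc k * (scale * rising k 0) + suc k ! * 0             ≡⟨ cong (suc k * (scale * rising k 0) +_) (*-zeroʳ (suc k !)) ⟩
    suc k * (scale * rising k 0) + 0                       ≡⟨ sym (*-rising-0 scale k) ⟩
    scale * rising (suc k) 0                               ∎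
    where open ≤-Reasoning
  geomSum-upper (suc Q) x x<QD = begin
    suc k ! * G x                                          ≡⟨ G-split x ⟩
    suc k * (k ! * w x) + suc k ! * shift G x D            ≤⟨ +-mono-≤ (*-monoʳ-≤ (suc k) (upper (suc Q) x x<QD)) (shifted (D ≤? x)) ⟩
    suc k * (scale * rising k (suc Q)) + scale * rising (suc k) Q ≡⟨ sym (*-rising-pascal scale k Q) ⟩
    scale * rising (suc k) (suc Q)                         ∎
    where
    open ≤-Reasoning
    shifted : Dec (D ≤ x) → suc k ! * shift G x D ≤ scale * rising (suc k) Q
    shifted (yes D≤x) = subst (λ z → suc k ! * z ≤ scale * rising (suc k) Q) (sym (shift-≤ G D≤x))
      (geomSum-upper Q (x ∸ D) (m<n+o⇒m∸n<o x D ⦃ >-nonZero (≤-trans 1≤D (m≤m+n D (Q * D))) ⦄ x<QD))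
    shifted (no D≰x) = subst (λ z → suc k ! * z ≤ scale * rising (suc k) Q) (sym (shift-> G (≰⇒> D≰x)))
      (subst (_≤ scale * rising (suc k) Q) (sym (*-zeroʳ (suc k !))) z≤n)

  geomSum-lower : ∀ q x → (q + L) * D ≤ x → scale * rising (suc k) q ≤ suc k ! * G x
  geomSum-lower zero x le = begin
    scale * rising (suc k) 0                               ≡⟨ *-rising-0 scale k ⟩
    suc k * (scale * rising k 0) + 0                       ≤⟨ +-mono-≤ (*-monoʳ-≤ (suc k) (lower zero x le)) z≤n ⟩
    suc k * (k ! * w x) + suc k ! * shift G x D            ≡⟨ sym (G-split x) ⟩
    suc k ! * G x                                          ∎
    where open ≤-Reasoning
  geomSum-lower (suc q) x le = begin
    scale * rising (suc k) (suc q)                         ≡⟨ *-rising-pascal scale k q ⟩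
    suc k * (scale * rising k (suc q)) + scale * rising (suc k) q ≤⟨ +-mono-≤ (*-monoʳ-≤ (suc k) (lower (suc q) x le)) shifted ⟩
    suc k * (k ! * w x) + suc k ! * shift G x D            ≡⟨ sym (G-split x) ⟩
    suc k ! * G x                                          ∎
    where
    open ≤-Reasoning
    D≤x : D ≤ x
    D≤x = ≤-trans (m≤m+n D _) le
    shifted : scale * rising (suc k) q ≤ suc k ! * shift G x D
    shifted = subst (λ z → scale * rising (suc k) q ≤ suc k ! * z) (sym (shift-≤ G D≤x))
      (geomSum-lower q (x ∸ D) (subst (_≤ x ∸ D) (m+n∸m≡n D _) (∸-monoˡ-≤ D le)))

  sandwich-geomSum : Sandwich (suc k) L D G
  sandwich-geomSum = record
    { scale = scale ; scale-pos = scale-pos ; upper = geomSum-upper ; lower = geomSum-lower }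

sandwich-Σ<-shift : ∀ {k L D} {v : ℕ → ℕ} a b → 1 ≤ b → b * a ≡ D → Sandwich k L D v →
  Sandwich k (suc L) D (λ n → Σ< (λ r → shift v n (r * a)) b)
sandwich-Σ<-shift {k} {L} {D} {v} a b 1≤b ba≡D bounds = record
  { scale = b * scale ; scale-pos = *-mono-≤ 1≤b scale-pos ; upper = upper′ ; lower = lower′ }
  where
  open Sandwich bounds
  upper′ : ∀ Q x → x < suc Q * D → k ! * Σ< (λ r → shift v x (r * a)) b ≤ b * scale * rising k Q
  upper′ Q x x<QD = begin
    k ! * Σ< (λ r → shift v x (r * a)) b          ≡⟨ *-distribˡ-Σ< (k !) _ b ⟩
    Σ< (λ r → k ! * shift v x (r * a)) b          ≤⟨ Σ<-≤ _ b _ (λ r _ → term r) ⟩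
    b * (scale * rising k Q)                      ≡⟨ sym (*-assoc b scale _) ⟩
    b * scale * rising k Q                        ∎
    where
    open ≤-Reasoning
    term : ∀ r → k ! * shift v x (r * a) ≤ scale * rising k Q
    term r with r * a ≤? x
    ... | yes ra≤x = subst (λ z → k ! * z ≤ scale * rising k Q) (sym (shift-≤ v ra≤x))
                       (upper Q (x ∸ r * a) (≤-<-trans (m∸n≤m x (r * a)) x<QD))
    ... | no ra≰x  = subst (λ z → k ! * z ≤ scale * rising k Q) (sym (shift-> v (≰⇒> ra≰x)))
                       (subst (_≤ scale * rising k Q) (sym (*-zeroʳ (k !))) z≤n)
  lower′ : ∀ q x → (q + suc L) * D ≤ x → b * scale * rising k q ≤ k ! * Σ< (λ r → shift v x (r * a)) b
  lower′ q x le = begin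
    b * scale * rising k q                        ≡⟨ *-assoc b scale _ ⟩
    b * (scale * rising k q)                      ≤⟨ Σ<-≥ _ b _ term ⟩
    Σ< (λ r → k ! * shift v x (r * a)) b          ≡⟨ sym (*-distribˡ-Σ< (k !) _ b) ⟩
    k ! * Σ< (λ r → shift v x (r * a)) b          ∎
    where
    open ≤-Reasoning
    D+qL≤x : D + (q + L) * D ≤ x
    D+qL≤x = subst (λ z → z * D ≤ x) (+-suc q L) le
    term : ∀ r → r < b → scale * rising k q ≤ k ! * shift v x (r * a)
    term r r<b = subst (λ z → scale * rising k q ≤ k ! * z) (sym (shift-≤ v ra≤x))
                   (lower q (x ∸ r * a) (subst (_≤ x ∸ r * a) (m+n∸m≡n (r * a) _) (∸-monoˡ-≤ (r * a) ra+qL≤x)))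
      where
      ra≤D : r * a ≤ D
      ra≤D = subst (r * a ≤_) ba≡D (*-monoˡ-≤ a (<⇒≤ r<b))
      ra+qL≤x : r * a + (q + L) * D ≤ x
      ra+qL≤x = ≤-trans (+-monoˡ-≤ _ ra≤D) D+qL≤x
      ra≤x : r * a ≤ x
      ra≤x = ≤-trans (m≤m+n (r * a) _) ra+qL≤x

sandwich-cong : ∀ {k L D} {g h : ℕ → ℕ} → (∀ x → g x ≡ h x) → Sandwich k L D g → Sandwich k L D h
sandwich-cong {k} {L} {D} {g} {h} g≗h bounds = record
  { scale = scale ; scale-pos = scale-pos
  ; upper = λ Q x lt → subst (λ z → k ! * z ≤ scale * rising k Q) (g≗h x) (upper Q x lt)
  ; lower = λ q x le → subst (λ z → scale * rising k q ≤ k ! * z) (g≗h x) (lower q x le)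
  }
  where open Sandwich bounds

pA-0-pos : ∀ a y → 0 < y → pA a 0 y ≡ 0
pA-0-pos a (suc y) _ = refl

module _ (a : ℕ → ℕ) (a-pos : ∀ i → 1 ≤ a i) {D : ℕ} (1≤D : 1 ≤ D) where

  -- Since (1 + ⋯ + x^(D−1))/(1 − x^D) = 1/(1 − x), this is n ↦ Σ_{m ≤ n} pA a k m.
  pA-cumulative : ℕ → ℕ → ℕ
  pA-cumulative k = geomSum D (window D (pA a k))

  window-pA-0-≥ : ∀ D′ x → D′ ≤ x → window D′ (pA a 0) x ≡ 0
  window-pA-0-≥ D′ x D′≤x = Σ<-zero _ D′ term
    where
    term : ∀ t → t < D′ → shift (pA a 0) x t ≡ 0
    term t t<D′ = trans (shift-≤ (pA a 0) (<⇒≤ t<x)) (pA-0-pos a (x ∸ t) (m<n⇒0<n∸m t<x))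
      where
      t<x : t < x
      t<x = <-≤-trans t<D′ D′≤x

  window-pA-0-< : ∀ x → x < D → window D (pA a 0) x ≡ 1
  window-pA-0-< x x<D = begin
    Σ< (shift (pA a 0) x) D                              ≡⟨ Σ<-truncate _ x<D (λ t x<t → shift-> (pA a 0) x<t) ⟩
    Σ< (shift (pA a 0) x) (suc x)                        ≡⟨ Σ<-snoc _ x ⟩
    window x (pA a 0) x + shift (pA a 0) x x             ≡⟨ cong₂ _+_ (window-pA-0-≥ x x ≤-refl) (shift-≤ (pA a 0) {x} ≤-refl) ⟩
    pA a 0 (x ∸ x)                                       ≡⟨ cong (pA a 0) (n∸n≡0 x) ⟩
    1                                                    ∎
    where open ≡-Reasoning

  pA-cumulative-0 : ∀ x → pA-cumulative 0 x ≡ 1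
  pA-cumulative-0 x = sym (geomSum-unique D (window D (pA a 0)) (λ _ → 1) 1≤D step x)
    where
    step : ∀ n → 1 ≡ window D (pA a 0) n + shift (λ _ → 1) n D
    step n with D ≤? n
    ... | yes D≤n = sym (cong₂ _+_ (window-pA-0-≥ D n D≤n) (shift-≤ (λ _ → 1) D≤n))
    ... | no D≰n  = sym (cong₂ _+_ (window-pA-0-< n (≰⇒> D≰n)) (shift-> (λ _ → 1) (≰⇒> D≰n)))

  window-pA-suc : ∀ k b → D ≡ b * a k → 1 ≤ b → ∀ x →
    window D (pA a (suc k)) x ≡ Σ< (λ r → shift (pA-cumulative k) x (r * a k)) b
  window-pA-suc k b D≡ba 1≤b x = begin
    window D (geomSum (a k) (pA a k)) x                                             ≡⟨ window-geomSum D (a k) (pA a k) (a-pos k) x ⟩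
    geomSum (a k) (window D (pA a k)) x                                             ≡⟨ geomSum-split (a k) b (window D (pA a k)) (a-pos k) 1≤b x ⟩
    Σ< (λ r → shift (geomSum (b * a k) (window D (pA a k))) x (r * a k)) b          ≡⟨ cong (λ E → Σ< (λ r → shift (geomSum E (window D (pA a k))) x (r * a k)) b) (sym D≡ba) ⟩
    Σ< (λ r → shift (pA-cumulative k) x (r * a k)) b                                ∎
    where open ≡-Reasoning

  sandwich-window-pA-suc : ∀ k → a k ∣ D → Sandwich k k D (pA-cumulative k) →
    Sandwich k (suc k) D (window D (pA a (suc k)))
  sandwich-window-pA-suc k (divides b D≡ba) bounds =
    sandwich-cong (λ x → sym (window-pA-suc k b D≡ba 1≤b x))
      (sandwich-Σ<-shift (a k) b 1≤b (sym D≡ba) bounds)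
    where
    1≤b : 1 ≤ b
    1≤b = n≢0⇒n>0 (λ b≡0 → <⇒≱ 1≤D (≤-reflexive (trans D≡ba (cong (_* a k) b≡0))))

  sandwich-pA-cumulative : ∀ K → (∀ i → i < K → a i ∣ D) → ∀ k → k ≤ K → Sandwich k k D (pA-cumulative k)
  sandwich-pA-cumulative K a∣D zero    _    = record
    { scale = 1 ; scale-pos = ≤-refl
    ; upper = λ Q x _ → ≤-reflexive (cong (_+ 0) (pA-cumulative-0 x))
    ; lower = λ q x _ → ≤-reflexive (cong (_+ 0) (sym (pA-cumulative-0 x)))
    }
  sandwich-pA-cumulative K a∣D (suc k) k<K = sandwich-geomSum 1≤D
    (sandwich-window-pA-suc k (a∣D k k<K) (sandwich-pA-cumulative K a∣D k (<⇒≤ k<K)))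

module _ {p : ℕ → ℕ} {X₀ : ℕ} (p-mono : ∀ n y → X₀ ≤ y → p n ≤ p (n + y)) (D : ℕ) where

  window-∸-≤ : ∀ n → X₀ ≤ n → window D p (n ∸ X₀) ≤ D * p n
  window-∸-≤ n X₀≤n = Σ<-≤ (shift p (n ∸ X₀)) D (p n) (λ t _ → term t)
    where
    term : ∀ t → shift p (n ∸ X₀) t ≤ p n
    term t with t ≤? n ∸ X₀
    ... | yes t≤ = subst₂ _≤_ (sym (shift-≤ p t≤)) (cong p back) (p-mono (n ∸ X₀ ∸ t) (X₀ + t) (m≤m+n X₀ t))
      where
      back : n ∸ X₀ ∸ t + (X₀ + t) ≡ n
      back = begin
        n ∸ X₀ ∸ t + (X₀ + t)    ≡⟨ cong (n ∸ X₀ ∸ t +_) (+-comm X₀ t) ⟩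
        n ∸ X₀ ∸ t + (t + X₀)    ≡⟨ sym (+-assoc (n ∸ X₀ ∸ t) t X₀) ⟩
        n ∸ X₀ ∸ t + t + X₀      ≡⟨ cong (_+ X₀) (m∸n+n≡m t≤) ⟩
        n ∸ X₀ + X₀              ≡⟨ m∸n+n≡m X₀≤n ⟩
        n                        ∎
        where open ≡-Reasoning
    ... | no t≰ = subst (_≤ p n) (sym (shift-> p (≰⇒> t≰))) z≤n

  window-+-≥ : ∀ n → D * p n ≤ window D p (n + (X₀ + D))
  window-+-≥ n = Σ<-≥ (shift p (n + (X₀ + D))) D (p n) term
    where
    term : ∀ t → t < D → p n ≤ shift p (n + (X₀ + D)) t
    term t t<D = subst (p n ≤_) (sym (trans (shift-≤ p t≤) (cong p ahead))) (p-mono n (X₀ + (D ∸ t)) (m≤m+n X₀ _))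
      where
      t≤X₀+D : t ≤ X₀ + D
      t≤X₀+D = ≤-trans (<⇒≤ t<D) (m≤n+m D X₀)
      t≤ : t ≤ n + (X₀ + D)
      t≤ = ≤-trans t≤X₀+D (m≤n+m _ n)
      ahead : n + (X₀ + D) ∸ t ≡ n + (X₀ + (D ∸ t))
      ahead = trans (+-∸-assoc n t≤X₀+D) (cong (n +_) (+-∸-assoc X₀ (<⇒≤ t<D)))

  module _ {k L : ℕ} (bounds : Sandwich k L D (window D p)) where

    open Sandwich bounds

    point-upper : ∀ Q n → n + (X₀ + D) < suc Q * D → k ! * D * p n ≤ scale * rising k Q
    point-upper Q n lt = begin
      k ! * D * p n                      ≡⟨ *-assoc (k !) D (p n) ⟩
      k ! * (D * p n)                    ≤⟨ *-monoʳ-≤ (k !) (window-+-≥ n) ⟩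
      k ! * window D p (n + (X₀ + D))    ≤⟨ upper Q _ lt ⟩
      scale * rising k Q                 ∎
      where open ≤-Reasoning

    point-lower : ∀ q n → (q + L) * D + X₀ ≤ n → scale * rising k q ≤ k ! * D * p n
    point-lower q n le = begin
      scale * rising k q                 ≤⟨ lower q (n ∸ X₀) (m+n≤o⇒m≤o∸n _ le) ⟩
      k ! * window D p (n ∸ X₀)          ≤⟨ *-monoʳ-≤ (k !) (window-∸-≤ n (≤-trans (m≤n+m X₀ _) le)) ⟩
      k ! * (D * p n)                    ≡⟨ sym (*-assoc (k !) D (p n)) ⟩
      k ! * D * p n                      ∎
      where open ≤-Reasoning

square-gap-transfer : ∀ {F c P₊ P₋ P₀ A B C} → 1 ≤ c →
  F * P₊ ≤ c * A → F * P₋ ≤ c * B → c * C ≤ F * P₀ → A * B < C * C → P₊ * P₋ < P₀ * P₀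
square-gap-transfer {F} {c} {P₊} {P₋} {P₀} {A} {B} {C} 1≤c FP₊≤ FP₋≤ ≤FP₀ AB<CC =
  *-cancelˡ-< (F * F) (P₊ * P₋) (P₀ * P₀) (begin-strict
    F * F * (P₊ * P₋)       ≡⟨ interchange F F P₊ P₋ ⟩
    F * P₊ * (F * P₋)       ≤⟨ *-mono-≤ FP₊≤ FP₋≤ ⟩
    c * A * (c * B)         ≡⟨ sym (interchange c c A B) ⟩
    c * c * (A * B)         <⟨ *-monoʳ-< (c * c) ⦃ >-nonZero (*-mono-≤ 1≤c 1≤c) ⦄ AB<CC ⟩
    c * c * (C * C)         ≡⟨ interchange c c C C ⟩
    c * C * (c * C)         ≤⟨ *-mono-≤ ≤FP₀ ≤FP₀ ⟩
    F * P₀ * (F * P₀)       ≡⟨ sym (interchange F F P₀ P₀) ⟩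
    F * F * (P₀ * P₀)       ∎)
  where
  open ≤-Reasoning
  interchange : ∀ a b x y → a * b * (x * y) ≡ a * x * (b * y)
  interchange = solve-∀

-- Monotonicity beyond the Frobenius bound

geomSum-mono-+ : ∀ a f c → 1 ≤ a → (∀ n → f n ≤ f (n + c)) → ∀ n → geomSum a f n ≤ geomSum a f (n + c)
geomSum-mono-+ a f c 1≤a f-mono = <-rec _ step
  where
  G = geomSum a f
  step : ∀ n → (∀ {m} → m < n → G m ≤ G (m + c)) → G n ≤ G (n + c)
  step n ih = subst₂ _≤_ (sym (geomSum-step a f n 1≤a)) (sym (geomSum-step a f (n + c) 1≤a))
                (+-mono-≤ (f-mono n) (shifted (a ≤? n)))
    where
    shifted : Dec (a ≤ n) → shift G n a ≤ shift G (n + c) a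
    shifted (yes a≤n) = subst₂ _≤_ (sym (shift-≤ G a≤n))
      (sym (trans (shift-≤ G (≤-trans a≤n (m≤m+n n c))) (cong G (+-∸-comm c a≤n))))
      (ih (∸-monoʳ-< 1≤a a≤n))
    shifted (no a≰n)  = subst (_≤ shift G (n + c) a) (sym (shift-> G (≰⇒> a≰n))) z≤n

geomSum-≤-+ : ∀ a f → 1 ≤ a → ∀ n → geomSum a f n ≤ geomSum a f (n + a)
geomSum-≤-+ a f 1≤a n = begin
  geomSum a f n                                   ≡⟨ sym (cong (geomSum a f) (m+n∸n≡m n a)) ⟩
  geomSum a f (n + a ∸ a)                         ≡⟨ sym (shift-≤ (geomSum a f) (m≤n+m a n)) ⟩
  shift (geomSum a f) (n + a) a                   ≤⟨ m≤n+m _ (f (n + a)) ⟩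
  f (n + a) + shift (geomSum a f) (n + a) a       ≡⟨ sym (geomSum-step a f (n + a) 1≤a) ⟩
  geomSum a f (n + a)                             ∎
  where open ≤-Reasoning

pA-≤-+ : ∀ a → (∀ i → 1 ≤ a i) → ∀ k i → i < k → ∀ n → pA a k n ≤ pA a k (n + a i)
pA-≤-+ a a-pos (suc k) i (s≤s i≤k) n with m≤n⇒m<n∨m≡n i≤k
... | inj₂ refl = geomSum-≤-+ (a i) (pA a i) (a-pos i) n
... | inj₁ i<k  = geomSum-mono-+ (a k) (pA a k) (a i) (a-pos k) (pA-≤-+ a a-pos k i i<k) n

data Representable (a : ℕ → ℕ) (k : ℕ) : ℕ → Set where
  zero-rep : Representable a k 0
  add-term : ∀ {x} i → i < k → Representable a k x → Representable a k (a i + x)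

pA-≤-representable : ∀ a → (∀ i → 1 ≤ a i) → ∀ k {x} → Representable a k x → ∀ n → pA a k n ≤ pA a k (n + x)
pA-≤-representable a a-pos k zero-rep n = ≤-reflexive (cong (pA a k) (sym (+-identityʳ n)))
pA-≤-representable a a-pos k (add-term {x} i i<k rep) n = begin
  pA a k n                 ≤⟨ pA-≤-representable a a-pos k rep n ⟩
  pA a k (n + x)           ≤⟨ pA-≤-+ a a-pos k i i<k (n + x) ⟩
  pA a k (n + x + a i)     ≡⟨ cong (pA a k) (regroup n x (a i)) ⟩
  pA a k (n + (a i + x))   ∎
  where
  open ≤-Reasoning
  regroup : ∀ n x y → n + x + y ≡ n + (y + x)
  regroup = solve-∀

map-applyUpTo : ∀ (f g : ℕ → ℕ) n → map f (applyUpTo g n) ≡ applyUpTo (f ∘ g) n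
map-applyUpTo f g zero    = refl
map-applyUpTo f g (suc n) = cong (f (g 0) ∷_) (map-applyUpTo f (g ∘ suc) n)

firstTerms-suc : ∀ a k → firstTerms a (suc k) ≡ a 0 ∷ firstTerms (a ∘ suc) k
firstTerms-suc a k = cong (a 0 ∷_) (trans (map-applyUpTo a suc k) (sym (map-applyUpTo (a ∘ suc) id k)))

gcdFirst-suc : ∀ a k → gcdFirst a (suc k) ≡ gcd (a 0) (gcdFirst (a ∘ suc) k)
gcdFirst-suc a k = cong (foldr gcd 0) (firstTerms-suc a k)

lcmFirst-suc : ∀ a k → lcmFirst a (suc k) ≡ lcm (a 0) (lcmFirst (a ∘ suc) k)
lcmFirst-suc a k = cong (foldr lcm 1) (firstTerms-suc a k)

gcdFirst-∣ : ∀ a k i → i < k → gcdFirst a k ∣ a i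
gcdFirst-∣ a (suc k) zero    _         = subst (_∣ a 0) (sym (gcdFirst-suc a k)) (gcd[m,n]∣m (a 0) _)
gcdFirst-∣ a (suc k) (suc i) (s≤s i<k) = subst (_∣ a (suc i)) (sym (gcdFirst-suc a k))
  (∣-trans (gcd[m,n]∣n (a 0) _) (gcdFirst-∣ (a ∘ suc) k i i<k))

∣-lcmFirst : ∀ a k i → i < k → a i ∣ lcmFirst a k
∣-lcmFirst a (suc k) zero    _         = subst (a 0 ∣_) (sym (lcmFirst-suc a k)) (m∣lcm[m,n] (a 0) _)
∣-lcmFirst a (suc k) (suc i) (s≤s i<k) = subst (a (suc i) ∣_) (sym (lcmFirst-suc a k))
  (∣-trans (∣-lcmFirst (a ∘ suc) k i i<k) (n∣lcm[m,n] (a 0) _))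

lcm-pos : ∀ m n → 1 ≤ m → 1 ≤ n → 1 ≤ lcm m n
lcm-pos m n 1≤m 1≤n = n≢0⇒n>0 λ lcm≡0 → <⇒≱ (*-mono-≤ 1≤m 1≤n)
  (≤-reflexive (trans (sym (gcd*lcm m n)) (trans (cong (gcd m n *_) lcm≡0) (*-zeroʳ (gcd m n)))))

lcmFirst-pos : ∀ a → (∀ i → 1 ≤ a i) → ∀ k → 1 ≤ lcmFirst a k
lcmFirst-pos a a-pos zero    = ≤-refl
lcmFirst-pos a a-pos (suc k) = subst (1 ≤_) (sym (lcmFirst-suc a k))
  (lcm-pos _ _ (a-pos 0) (lcmFirst-pos (a ∘ suc) (a-pos ∘ suc) k))

module _ (a₀ g x s : ℕ) {d : ℕ} (1≤g : 1 ≤ g) (x≡sd : x ≡ s * d) (ga₀≤x : g * a₀ ≤ x) where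

  private
    instance
      g≢0 : NonZero g
      g≢0 = >-nonZero 1≤g

    ca₀≤x : ∀ {c} → c ≤ g → c * a₀ ≤ x
    ca₀≤x c≤g = ≤-trans (*-monoˡ-≤ a₀ c≤g) ga₀≤x

  -- d + y g = u a₀ gives x ≡ s u a₀ (mod g), so c = (s u) mod g.
  residue-from-bezout₊ : ∀ u y → d + y * g ≡ u * a₀ → ∃ λ c → c ≤ g × g ∣ x ∸ c * a₀
  residue-from-bezout₊ u y eq = c , <⇒≤ (m%n<n N g) ,
    ∣m+n∣m⇒∣n (subst (g ∣_) (sym balance) (divides (w * a₀) (identity₃ w g a₀))) (divides (s * y) refl)
    where
    N = s * u
    c = N % g
    w = N / g
    identity₁ : ∀ s d y g → s * (d + y * g) ≡ s * d + s * y * g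
    identity₁ = solve-∀
    identity₂ : ∀ s u a₀ → s * (u * a₀) ≡ s * u * a₀
    identity₂ = solve-∀
    identity₃ : ∀ w g a₀ → w * g * a₀ ≡ w * a₀ * g
    identity₃ = solve-∀
    x+syg : x + s * y * g ≡ c * a₀ + w * g * a₀
    x+syg = begin
      x + s * y * g           ≡⟨ cong (_+ s * y * g) x≡sd ⟩
      s * d + s * y * g       ≡⟨ sym (identity₁ s d y g) ⟩
      s * (d + y * g)         ≡⟨ cong (s *_) eq ⟩
      s * (u * a₀)            ≡⟨ identity₂ s u a₀ ⟩
      N * a₀                  ≡⟨ cong (_* a₀) (m≡m%n+[m/n]*n N g) ⟩
      (c + w * g) * a₀        ≡⟨ *-distribʳ-+ a₀ c (w * g) ⟩
      c * a₀ + w * g * a₀     ∎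
      where open ≡-Reasoning
    balance : s * y * g + (x ∸ c * a₀) ≡ w * g * a₀
    balance = +-cancelˡ-≡ (c * a₀) _ _ (begin
      c * a₀ + (s * y * g + (x ∸ c * a₀))  ≡⟨ cong (c * a₀ +_) (+-comm (s * y * g) _) ⟩
      c * a₀ + ((x ∸ c * a₀) + s * y * g)  ≡⟨ sym (+-assoc (c * a₀) _ _) ⟩
      c * a₀ + (x ∸ c * a₀) + s * y * g    ≡⟨ cong (_+ s * y * g) (m+[n∸m]≡n (ca₀≤x (<⇒≤ (m%n<n N g)))) ⟩
      x + s * y * g                         ≡⟨ x+syg ⟩
      c * a₀ + w * g * a₀                   ∎)
      where open ≡-Reasoning

  -- d + u a₀ = y g gives x ≡ −(s u) a₀ (mod g), so c = g − (s u) mod g.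
  residue-from-bezout₋ : ∀ u y → d + u * a₀ ≡ y * g → ∃ λ c → c ≤ g × g ∣ x ∸ c * a₀
  residue-from-bezout₋ u y eq = c , m∸n≤m g r ,
    ∣m+n∣m⇒∣n (subst (g ∣_) (sym balance) (divides (s * y) refl)) (divides (a₀ + w * a₀) (identity₂ g a₀ w))
    where
    N = s * u
    r = N % g
    c = g ∸ r
    w = N / g
    r≤g : r ≤ g
    r≤g = <⇒≤ (m%n<n N g)
    identity₁ : ∀ s d u a₀ → s * (d + u * a₀) ≡ s * d + s * u * a₀
    identity₁ = solve-∀
    identity₂ : ∀ g a₀ w → g * a₀ + w * g * a₀ ≡ (a₀ + w * a₀) * g
    identity₂ = solve-∀
    identity₃ : ∀ c r w g a₀ → c * a₀ + (r + w * g) * a₀ ≡ (c + r) * a₀ + w * g * a₀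
    identity₃ = solve-∀
    ca₀+Na₀ : c * a₀ + N * a₀ ≡ g * a₀ + w * g * a₀
    ca₀+Na₀ = begin
      c * a₀ + N * a₀               ≡⟨ cong (λ z → c * a₀ + z * a₀) (m≡m%n+[m/n]*n N g) ⟩
      c * a₀ + (r + w * g) * a₀     ≡⟨ identity₃ c r w g a₀ ⟩
      (c + r) * a₀ + w * g * a₀     ≡⟨ cong (λ z → z * a₀ + w * g * a₀) (m∸n+n≡m r≤g) ⟩
      g * a₀ + w * g * a₀           ∎
      where open ≡-Reasoning
    balance : (g * a₀ + w * g * a₀) + (x ∸ c * a₀) ≡ s * y * g
    balance = begin
      (g * a₀ + w * g * a₀) + (x ∸ c * a₀)  ≡⟨ cong (_+ (x ∸ c * a₀)) (sym ca₀+Na₀) ⟩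
      (c * a₀ + N * a₀) + (x ∸ c * a₀)      ≡⟨ +-comm (c * a₀ + N * a₀) _ ⟩
      (x ∸ c * a₀) + (c * a₀ + N * a₀)      ≡⟨ sym (+-assoc (x ∸ c * a₀) _ _) ⟩
      (x ∸ c * a₀) + c * a₀ + N * a₀        ≡⟨ cong (_+ N * a₀) (m∸n+n≡m (ca₀≤x (m∸n≤m g r))) ⟩
      x + N * a₀                            ≡⟨ cong (_+ N * a₀) x≡sd ⟩
      s * d + s * u * a₀                    ≡⟨ sym (identity₁ s d u a₀) ⟩
      s * (d + u * a₀)                      ≡⟨ cong (s *_) eq ⟩
      s * (y * g)                           ≡⟨ sym (*-assoc s y g) ⟩
      s * y * g                             ∎
      where open ≡-Reasoning

residue-by-multiples : ∀ a₀ g x → 1 ≤ g → gcd a₀ g ∣ x → g * a₀ ≤ x → ∃ λ c → c ≤ g × g ∣ x ∸ c * a₀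
residue-by-multiples a₀ g x 1≤g (divides s x≡sd) ga₀≤x with Bézout.identity (gcd-GCD a₀ g)
... | Bézout.+- u y eq = residue-from-bezout₊ a₀ g x s 1≤g x≡sd ga₀≤x u y eq
... | Bézout.-+ u y eq = residue-from-bezout₋ a₀ g x s 1≤g x≡sd ga₀≤x u y eq

-- Up to gcd(a₂,…,a_k) copies of a₁ fix the residue modulo gcd(a₂,…,a_k).
frobeniusBound : (ℕ → ℕ) → ℕ → ℕ
frobeniusBound a zero    = 0
frobeniusBound a (suc k) = gcdFirst (a ∘ suc) k * a 0 + frobeniusBound (a ∘ suc) k

representable-lift : ∀ a k {x} → Representable (a ∘ suc) k x → Representable a (suc k) x
representable-lift a k zero-rep           = zero-rep
representable-lift a k (add-term i i<k r) = add-term (suc i) (s≤s i<k) (representable-lift a k r)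

representable-copies : ∀ a k c {y} → Representable a (suc k) y → Representable a (suc k) (c * a 0 + y)
representable-copies a k zero    r = r
representable-copies a k (suc c) {y} r = subst (Representable a (suc k)) (sym (+-assoc (a 0) (c * a 0) y))
  (add-term 0 (s≤s z≤n) (representable-copies a k c r))

representable-≥ : ∀ k a → (∀ i → 1 ≤ a i) → ∀ x → gcdFirst a k ∣ x → frobeniusBound a k ≤ x → Representable a k x
representable-≥ zero a a-pos x 0∣x _ = subst (Representable a 0) (sym (0∣⇒≡0 0∣x)) zero-rep
representable-≥ (suc zero) a a-pos x a₀∣x _ with subst (_∣ x) (trans (gcdFirst-suc a 0) (gcd-identityʳ (a 0))) a₀∣x
... | divides s x≡sa₀ = subst (Representable a 1) (trans (+-identityʳ _) (sym x≡sa₀)) (representable-copies a 0 s zero-rep)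
representable-≥ (suc (suc k)) a a-pos x d∣x bound≤x =
  subst (Representable a (2 + k)) (m+[n∸m]≡n ca₀≤x)
    (representable-copies a (suc k) c (representable-lift a (suc k)
      (representable-≥ (suc k) (a ∘ suc) (a-pos ∘ suc) (x ∸ c * a 0) g∣rest bound≤rest)))
  where
  g = gcdFirst (a ∘ suc) (suc k)
  1≤g : 1 ≤ g
  1≤g = n≢0⇒n>0 λ g≡0 → <⇒≱ (a-pos 1)
    (≤-reflexive (0∣⇒≡0 (subst (_∣ a 1) g≡0 (gcdFirst-∣ (a ∘ suc) (suc k) 0 (s≤s z≤n)))))
  ga₀≤x : g * a 0 ≤ x
  ga₀≤x = ≤-trans (m≤m+n (g * a 0) _) bound≤x
  residue = residue-by-multiples (a 0) g x 1≤g (subst (_∣ x) (gcdFirst-suc a (suc k)) d∣x) ga₀≤x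
  c = proj₁ residue
  c≤g = proj₁ (proj₂ residue)
  g∣rest = proj₂ (proj₂ residue)
  ca₀≤x : c * a 0 ≤ x
  ca₀≤x = ≤-trans (*-monoˡ-≤ (a 0) c≤g) ga₀≤x
  bound≤rest : frobeniusBound (a ∘ suc) (suc k) ≤ x ∸ c * a 0
  bound≤rest = m+n≤o⇒m≤o∸n F′ (begin
    F′ + c * a 0    ≤⟨ +-monoʳ-≤ F′ (*-monoˡ-≤ (a 0) c≤g) ⟩
    F′ + g * a 0    ≡⟨ +-comm F′ (g * a 0) ⟩
    g * a 0 + F′    ≤⟨ bound≤x ⟩
    x               ∎)
    where
    open ≤-Reasoning
    F′ = frobeniusBound (a ∘ suc) (suc k)

gcdFirst-tail-≤-lcmFirst : ∀ a → (∀ i → 1 ≤ a i) → ∀ k → gcdFirst (a ∘ suc) k ≤ lcmFirst a (suc k)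
gcdFirst-tail-≤-lcmFirst a a-pos zero    = z≤n
gcdFirst-tail-≤-lcmFirst a a-pos (suc k) = ∣⇒≤ ⦃ >-nonZero (lcmFirst-pos a a-pos (2 + k)) ⦄
  (∣-trans (gcdFirst-∣ (a ∘ suc) (suc k) 0 (s≤s z≤n)) (∣-lcmFirst a (2 + k) 1 (s≤s (s≤s z≤n))))

frobeniusBound-≤ : ∀ k a → (∀ i → 1 ≤ a i) → frobeniusBound a k ≤ k * (lcmFirst a k * lcmFirst a k)
frobeniusBound-≤ zero    a a-pos = z≤n
frobeniusBound-≤ (suc k) a a-pos = +-mono-≤ (*-mono-≤ g≤L a₀≤L)
  (≤-trans (frobeniusBound-≤ k (a ∘ suc) (a-pos ∘ suc)) (*-monoʳ-≤ k (*-mono-≤ L′≤L L′≤L)))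
  where
  L = lcmFirst a (suc k)
  L′ = lcmFirst (a ∘ suc) k
  instance
    L≢0 : NonZero L
    L≢0 = >-nonZero (lcmFirst-pos a a-pos (suc k))
  L′≤L : L′ ≤ L
  L′≤L = ∣⇒≤ (subst (L′ ∣_) (sym (lcmFirst-suc a k)) (n∣lcm[m,n] (a 0) L′))
  a₀≤L : a 0 ≤ L
  a₀≤L = ∣⇒≤ (∣-lcmFirst a (suc k) 0 (s≤s z≤n))
  g≤L : gcdFirst (a ∘ suc) k ≤ L
  g≤L = gcdFirst-tail-≤-lcmFirst a a-pos k

-- Choice of the comparison indices

square-gap : ∀ Z w δ E → E + δ + 1 ≡ Z + w → 2 * w * (Z + w) < δ * δ → (Z + w + δ) * E < Z * Z
square-gap Z w δ E E+δ+1≡Z+w 2w[Z+w]<δ² = +-cancelʳ-< (δ * δ) ((Z + w + δ) * E) (Z * Z) (begin-strict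
  (Z + w + δ) * E + δ * δ                         ≤⟨ m≤m+n _ (E + 2 * δ + 1) ⟩
  (Z + w + δ) * E + δ * δ + (E + 2 * δ + 1)       ≡⟨ subst (λ u → (u + δ) * E + δ * δ + (E + 2 * δ + 1) ≡ u * u) E+δ+1≡Z+w (square E δ) ⟩
  (Z + w) * (Z + w)                               ≤⟨ m≤m+n _ (w * w) ⟩
  (Z + w) * (Z + w) + w * w                       ≡⟨ expand Z w ⟩
  Z * Z + 2 * w * (Z + w)                         <⟨ +-monoʳ-< (Z * Z) 2w[Z+w]<δ² ⟩
  Z * Z + δ * δ                                   ∎)
  where
  open ≤-Reasoning
  square : ∀ E δ → (E + δ + 1 + δ) * E + δ * δ + (E + 2 * δ + 1) ≡ (E + δ + 1) * (E + δ + 1)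
  square = solve-∀
  expand : ∀ Z w → (Z + w) * (Z + w) + w * w ≡ Z * Z + 2 * w * (Z + w)
  expand = solve-∀

linear-bound-from-square : ∀ K P m d → d < m → 4 * m * P < K * (d * d) → 4 * P < K * m
linear-bound-from-square K P m d d<m 4mP<Kd² = *-cancelˡ-< m (4 * P) (K * m) (begin-strict
  m * (4 * P)        ≡⟨ reorder₁ m P ⟩
  4 * m * P          <⟨ 4mP<Kd² ⟩
  K * (d * d)        ≤⟨ *-monoʳ-≤ K (*-mono-≤ (<⇒≤ d<m) (<⇒≤ d<m)) ⟩
  K * (m * m)        ≡⟨ reorder₂ K m ⟩
  m * (K * m)        ∎)
  where
  open ≤-Reasoning
  reorder₁ : ∀ m P → m * (4 * P) ≡ 4 * m * P
  reorder₁ = solve-∀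
  reorder₂ : ∀ K m → K * (m * m) ≡ m * (K * m)
  reorder₂ = solve-∀

-- Each polynomial inequality between expressions in K = 2 + k and D = 1 + e is
-- proved by writing the difference as a polynomial in k and e with nonnegative
-- coefficients.
module Indices (k e : ℕ) where

  K = 2 + k
  D = suc e
  s = K * D
  w = 2 * s + K + 2
  P₂ = (1 + D * K) * (1 + 2 * D * K)

  P₂-bound₁ : 2 * K * w * D + 2 * K * D + 2 * K * K * (D * D) ≤ 4 * P₂
  P₂-bound₁ = ≤-trans (m≤m+n _ _) (≤-reflexive (sym (difference k e)))
    where
    difference : ∀ k e → 4 * ((1 + suc e * (2 + k)) * (1 + 2 * suc e * (2 + k))) ≡
      (2 * (2 + k) * (2 * ((2 + k) * suc e) + (2 + k) + 2) * suc e + 2 * (2 + k) * suc e)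
      + 2 * (2 + k) * (2 + k) * (suc e * suc e)
      + (16 + 20 * e + 8 * e * e + 6 * k + 14 * k * e + 8 * k * e * e + 2 * k * k * e + 2 * k * k * e * e)
    difference = solve-∀

  P₂-bound₂ : 2 * w * (s + K + 1) + 1 ≤ 8 * P₂ + 2
  P₂-bound₂ = ≤-trans (m≤m+n _ _) (≤-reflexive (sym (difference k e)))
    where
    difference : ∀ k e → 8 * ((1 + suc e * (2 + k)) * (1 + 2 * suc e * (2 + k))) + 2 ≡
      2 * (2 * ((2 + k) * suc e) + (2 + k) + 2) * ((2 + k) * suc e + (2 + k) + 1) + 1
      + (41 + 104 * e + 48 * e * e + 26 * k + 88 * k * e + 48 * k * e * e + 4 * k * k + 18 * k * k * e + 12 * k * k * e * e)
    difference = solve-∀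

  P₂-bound₃ : K * ((s + K) * D) ≤ 4 * P₂
  P₂-bound₃ = ≤-trans (m≤m+n _ _) (≤-reflexive (sym (difference k e)))
    where
    difference : ∀ k e → 4 * ((1 + suc e * (2 + k)) * (1 + 2 * suc e * (2 + k))) ≡
      (2 + k) * (((2 + k) * suc e + (2 + k)) * suc e)
      + (52 + 76 * e + 28 * e * e + 36 * k + 64 * k * e + 28 * k * e * e + 6 * k * k + 13 * k * k * e + 7 * k * k * e * e)
    difference = solve-∀

  d-large : ∀ m d → 4 * P₂ < K * m → 4 * m * P₂ < K * (d * d) →
    2 * w * D * (m + (s + K + 1) * D) + 2 * m * D + D * D < d * d
  d-large m d 4P₂<Km 4mP₂<Kd² = *-cancelˡ-< K _ (d * d) (begin-strict
    K * (2 * w * D * (m + (s + K + 1) * D) + 2 * m * D + D * D)   ≡⟨ expand K D s w m ⟩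
    m * A + B                                                    ≤⟨ +-monoʳ-≤ (m * A) B≤ ⟩
    m * A + 2 * (D * D) * K * (4 * P₂ + 1)                       ≤⟨ +-monoʳ-≤ (m * A) (*-monoʳ-≤ (2 * (D * D) * K) (subst (_≤ K * m) (+-comm 1 (4 * P₂)) 4P₂<Km)) ⟩
    m * A + 2 * (D * D) * K * (K * m)                            ≡⟨ collect m A K D ⟩
    m * (A + 2 * K * K * (D * D))                                ≤⟨ *-monoʳ-≤ m P₂-bound₁ ⟩
    m * (4 * P₂)                                                 ≡⟨ reorder m P₂ ⟩
    4 * m * P₂                                                   <⟨ 4mP₂<Kd² ⟩
    K * (d * d)                                                  ∎)
    where
    open ≤-Reasoning
    A = 2 * K * w * D + 2 * K * D
    B = 2 * K * w * (D * D) * (s + K + 1) + K * (D * D)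
    expand : ∀ K D s w m → K * (2 * w * D * (m + (s + K + 1) * D) + 2 * m * D + D * D) ≡
      m * (2 * K * w * D + 2 * K * D) + (2 * K * w * (D * D) * (s + K + 1) + K * (D * D))
    expand = solve-∀
    collect : ∀ m A K D → m * A + 2 * (D * D) * K * (K * m) ≡ m * (A + 2 * K * K * (D * D))
    collect = solve-∀
    reorder : ∀ m P → m * (4 * P) ≡ 4 * m * P
    reorder = solve-∀
    scale : ∀ K D s w → K * (D * D) * (2 * w * (s + K + 1) + 1) ≡ 2 * K * w * (D * D) * (s + K + 1) + K * (D * D)
    scale = solve-∀
    factor : ∀ K D P → K * (D * D) * (8 * P + 2) ≡ 2 * (D * D) * K * (4 * P + 1)
    factor = solve-∀
    B≤ : B ≤ 2 * (D * D) * K * (4 * P₂ + 1)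
    B≤ = begin
      B                                            ≡⟨ sym (scale K D s w) ⟩
      K * (D * D) * (2 * w * (s + K + 1) + 1)      ≤⟨ *-monoʳ-≤ (K * (D * D)) P₂-bound₂ ⟩
      K * (D * D) * (8 * P₂ + 2)                   ≡⟨ factor K D P₂ ⟩
      2 * (D * D) * K * (4 * P₂ + 1)               ∎

  module Choice (m d : ℕ) (d<m : d < m) (4mP₂<Kd² : 4 * m * P₂ < K * (d * d)) where

    Q₀ = m / D
    δ = d / D

    Q₀D≤m : Q₀ * D ≤ m
    Q₀D≤m = subst (Q₀ * D ≤_) (sym (m≡m%n+[m/n]*n m D)) (m≤n+m (Q₀ * D) (m % D))

    m<Q₀D : m < suc Q₀ * D
    m<Q₀D = subst (_< suc Q₀ * D) (sym (m≡m%n+[m/n]*n m D)) (+-monoˡ-< (Q₀ * D) (m%n<n m D))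

    δD≤d : δ * D ≤ d
    δD≤d = subst (δ * D ≤_) (sym (m≡m%n+[m/n]*n d D)) (m≤n+m (δ * D) (d % D))

    d<δD : d < suc δ * D
    d<δD = subst (_< suc δ * D) (sym (m≡m%n+[m/n]*n d D)) (+-monoˡ-< (δ * D) (m%n<n d D))

    4P₂<Km : 4 * P₂ < K * m
    4P₂<Km = linear-bound-from-square K P₂ m d d<m 4mP₂<Kd²

    sK≤Q₀ : s + K ≤ Q₀
    sK≤Q₀ = ≮⇒≥ λ Q₀<sK → <⇒≱ 4P₂<Km (≤-trans (*-monoʳ-≤ K (≤-trans (<⇒≤ m<Q₀D) (*-monoˡ-≤ D Q₀<sK))) P₂-bound₃)

    δ≤Q₀ : δ ≤ Q₀
    δ≤Q₀ = ≤-pred (*-cancelʳ-< D δ (suc Q₀) (≤-<-trans δD≤d (<-trans d<m m<Q₀D)))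

    quotient-gap : 2 * w * (Q₀ + s + K + 1) < δ * δ
    quotient-gap = +-cancelʳ-< (2 * δ + 1) G (δ * δ) (*-cancelˡ-< (D * D) (G + (2 * δ + 1)) (δ * δ + (2 * δ + 1)) (begin-strict
      D * D * (G + (2 * δ + 1))                                         ≡⟨ expand₁ D w Q₀ s K δ ⟩
      2 * w * D * (Q₀ * D + (s + K + 1) * D) + 2 * (δ * D) * D + D * D  ≤⟨ +-monoˡ-≤ (D * D) (+-mono-≤ (*-monoʳ-≤ (2 * w * D) (+-monoˡ-≤ _ Q₀D≤m)) (*-monoˡ-≤ D (*-monoʳ-≤ 2 (≤-trans δD≤d (<⇒≤ d<m))))) ⟩
      2 * w * D * (m + (s + K + 1) * D) + 2 * m * D + D * D             <⟨ d-large m d 4P₂<Km 4mP₂<Kd² ⟩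
      d * d                                                             <⟨ *-mono-< d<δD d<δD ⟩
      suc δ * D * (suc δ * D)                                           ≡⟨ expand₂ D δ ⟩
      D * D * (δ * δ + (2 * δ + 1))                                     ∎))
      where
      open ≤-Reasoning
      G = 2 * w * (Q₀ + s + K + 1)
      expand₁ : ∀ D w Q₀ s K δ → D * D * (2 * w * (Q₀ + s + K + 1) + (2 * δ + 1)) ≡
        2 * w * D * (Q₀ * D + (s + K + 1) * D) + 2 * (δ * D) * D + D * D
      expand₁ = solve-∀
      expand₂ : ∀ D δ → suc δ * D * (suc δ * D) ≡ D * D * (δ * δ + (2 * δ + 1))
      expand₂ = solve-∀

    f = Q₀ ∸ (s + K)
    Q₊ = Q₀ + δ + s + 2
    Q₋ = Q₀ ∸ δ + s + 1

    sK+f≡Q₀ : s + K + f ≡ Q₀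
    sK+f≡Q₀ = m+[n∸m]≡n sK≤Q₀

    δ+[Q₀∸δ]≡Q₀ : δ + (Q₀ ∸ δ) ≡ Q₀
    δ+[Q₀∸δ]≡Q₀ = m+[n∸m]≡n δ≤Q₀

    factor-gap : ∀ j → j ≤ suc k → (Q₊ + j) * (Q₋ + j) < (f + j) * (f + j)
    factor-gap j j≤k+1 = subst (λ z → z * (Q₋ + j) < (f + j) * (f + j)) sum₊
      (square-gap (f + j) w δ (Q₋ + j) sum₋ (≤-<-trans (*-monoʳ-≤ (2 * w) f+j+w≤) quotient-gap))
      where
      open ≡-Reasoning
      reorder₁ : ∀ e′ s j δ → e′ + s + 1 + j + δ + 1 ≡ δ + e′ + s + j + 2
      reorder₁ = solve-∀
      reorder₂ : ∀ s K f j → s + K + f + s + j + 2 ≡ f + j + (2 * s + K + 2)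
      reorder₂ = solve-∀
      reorder₃ : ∀ s K f j δ → f + j + (2 * s + K + 2) + δ ≡ s + K + f + δ + s + 2 + j
      reorder₃ = solve-∀
      reorder₄ : ∀ s k f → f + suc k + (2 * s + (2 + k) + 2) ≡ s + (2 + k) + f + s + (2 + k) + 1
      reorder₄ = solve-∀
      sum₋ : Q₋ + j + δ + 1 ≡ f + j + w
      sum₋ = begin
        Q₋ + j + δ + 1                  ≡⟨ reorder₁ (Q₀ ∸ δ) s j δ ⟩
        δ + (Q₀ ∸ δ) + s + j + 2        ≡⟨ cong (λ z → z + s + j + 2) (trans δ+[Q₀∸δ]≡Q₀ (sym sK+f≡Q₀)) ⟩
        s + K + f + s + j + 2           ≡⟨ reorder₂ s K f j ⟩
        f + j + w                       ∎
      sum₊ : f + j + w + δ ≡ Q₊ + j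
      sum₊ = trans (reorder₃ s K f j δ) (cong (λ z → z + δ + s + 2 + j) sK+f≡Q₀)
      f+j+w≤ : f + j + w ≤ Q₀ + s + K + 1
      f+j+w≤ = ≤-trans (+-monoˡ-≤ w (+-monoʳ-≤ f j≤k+1))
        (≤-reflexive (trans (reorder₄ s k f) (cong (λ z → z + s + K + 1) sK+f≡Q₀)))

    rising-gap : rising (suc k) Q₊ * rising (suc k) Q₋ < rising (suc k) f * rising (suc k) f
    rising-gap = rising-*-< k f Q₊ Q₋ (λ j _ j≤k+1 → factor-gap j j≤k+1)

    Q₀D-split : suc Q₀ * D ≡ δ * D + suc (Q₀ ∸ δ) * D
    Q₀D-split = begin
      suc Q₀ * D                       ≡⟨ cong (λ z → suc z * D) (sym δ+[Q₀∸δ]≡Q₀) ⟩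
      suc (δ + (Q₀ ∸ δ)) * D           ≡⟨ cong (_* D) (sym (+-suc δ (Q₀ ∸ δ))) ⟩
      (δ + suc (Q₀ ∸ δ)) * D           ≡⟨ *-distribʳ-+ D δ _ ⟩
      δ * D + suc (Q₀ ∸ δ) * D         ∎
      where open ≡-Reasoning

    module _ {X₀ : ℕ} (X₀≤KD² : X₀ ≤ K * (D * D)) where

      X₀≤sD : X₀ ≤ s * D
      X₀≤sD = subst (X₀ ≤_) (sym (*-assoc K D D)) X₀≤KD²

      upper₊ : m + d + (X₀ + D) < suc Q₊ * D
      upper₊ = begin-strict
        m + d + (X₀ + D)                         ≤⟨ +-monoʳ-≤ (m + d) (+-monoˡ-≤ D X₀≤sD) ⟩
        m + d + (s * D + D)                      <⟨ +-monoˡ-< (s * D + D) (+-mono-< m<Q₀D d<δD) ⟩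
        suc Q₀ * D + suc δ * D + (s * D + D)     ≡⟨ collect D Q₀ δ s ⟩
        suc Q₊ * D                               ∎
        where
        open ≤-Reasoning
        collect : ∀ D Q₀ δ s → suc Q₀ * D + suc δ * D + (s * D + D) ≡ suc (Q₀ + δ + s + 2) * D
        collect = solve-∀

      upper₋ : m ∸ d + (X₀ + D) < suc Q₋ * D
      upper₋ = begin-strict
        m ∸ d + (X₀ + D)                         ≤⟨ +-mono-≤ (∸-monoʳ-≤ m δD≤d) (+-monoˡ-≤ D X₀≤sD) ⟩
        m ∸ δ * D + (s * D + D)                  <⟨ +-monoˡ-< (s * D + D) m∸δD< ⟩
        suc (Q₀ ∸ δ) * D + (s * D + D)           ≡⟨ collect D (Q₀ ∸ δ) s ⟩
        suc Q₋ * D                               ∎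
        where
        open ≤-Reasoning
        collect : ∀ D e′ s → suc e′ * D + (s * D + D) ≡ suc (e′ + s + 1) * D
        collect = solve-∀
        m∸δD< : m ∸ δ * D < suc (Q₀ ∸ δ) * D
        m∸δD< = subst (m ∸ δ * D <_) (m+n∸m≡n (δ * D) _)
          (∸-monoˡ-< (subst (m <_) Q₀D-split m<Q₀D) (≤-trans δD≤d (<⇒≤ d<m)))

      lower₀ : (f + K) * D + X₀ ≤ m
      lower₀ = begin
        (f + K) * D + X₀        ≤⟨ +-monoʳ-≤ ((f + K) * D) X₀≤sD ⟩
        (f + K) * D + s * D     ≡⟨ collect f K s D ⟩
        (s + K + f) * D         ≡⟨ cong (_* D) sK+f≡Q₀ ⟩
        Q₀ * D                  ≤⟨ Q₀D≤m ⟩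
        m                       ∎
        where
        open ≤-Reasoning
        collect : ∀ f K s D → (f + K) * D + s * D ≡ (s + K + f) * D
        collect = solve-∀

strictly-log-concave : ∀ k e {p : ℕ → ℕ} {X₀} →
  (∀ n y → X₀ ≤ y → p n ≤ p (n + y)) → X₀ ≤ (2 + k) * (suc e * suc e) →
  Sandwich (suc k) (2 + k) (suc e) (window (suc e) p) →
  ∀ m d → d < m → 4 * m * Indices.P₂ k e < (2 + k) * (d * d) → p (m + d) * p (m ∸ d) < p m * p m
strictly-log-concave k e {p} p-mono X₀≤ bounds m d d<m 4mP₂<Kd² =
  square-gap-transfer {F = suc k ! * D} {P₊ = p (m + d)} {P₋ = p (m ∸ d)} {P₀ = p m} scale-pos
    (point-upper p-mono D bounds Q₊ (m + d) (upper₊ X₀≤))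
    (point-upper p-mono D bounds Q₋ (m ∸ d) (upper₋ X₀≤))
    (point-lower p-mono D bounds f m (lower₀ X₀≤))
    rising-gap
  where
  open Indices k e
  open Choice m d d<m 4mP₂<Kd²
  open Sandwich bounds

product-pos : ∀ (f : ℕ → ℕ) xs → (∀ x → 1 ≤ f x) → 1 ≤ product (map f xs)
product-pos f []       f-pos = ≤-refl
product-pos f (x ∷ xs) f-pos = *-mono-≤ (f-pos x) (product-pos f xs f-pos)

boundProd-≥ : ∀ D k → (1 + D * (2 + k)) * (1 + 2 * D * (2 + k)) ≤ boundProd D (2 + k)
boundProd-≥ D k = ≤-trans (≤-reflexive (unit D (2 + k)))
  (*-monoʳ-≤ (1 + 1 * D * (2 + k)) (*-monoʳ-≤ (1 + 2 * D * (2 + k))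
    (product-pos (λ i → 1 + suc i * D * (2 + k)) (applyUpTo (suc ∘ suc) k) (λ _ → s≤s z≤n))))
  where
  unit : ∀ D K → (1 + D * K) * (1 + 2 * D * K) ≡ (1 + 1 * D * K) * ((1 + 2 * D * K) * 1)
  unit = solve-∀

corollary3p3 :
    (a : ℕ → ℕ) →
    (∀ i → 1 ≤ a i) →
    (∀ i j → i ≤ j → a i ≤ a j) →
    (k : ℕ) → 2 ≤ k →
    gcdFirst a k ≡ 1 →
    (m d : ℕ) → 0 < d → d < m →
    k * (d * d) > 4 * m * boundProd (lcmFirst a k) k →
    pA a k m * pA a k m > pA a k (m + d) * pA a k (m ∸ d)
corollary3p3 a a-pos _ (suc (suc k)) (s≤s (s≤s z≤n)) gcd≡1 m d _ d<m hyp =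
  strictly-log-concave k e p-mono X₀≤ bounds m d d<m (≤-<-trans (*-monoʳ-≤ (4 * m) (boundProd-≥ (suc e) k)) hyp′)
  where
  K = 2 + k
  e = proj₁ (m≤n⇒∃[o]m+o≡n (lcmFirst-pos a a-pos K))
  L≡D : lcmFirst a K ≡ suc e
  L≡D = sym (proj₂ (m≤n⇒∃[o]m+o≡n (lcmFirst-pos a a-pos K)))
  a∣D : ∀ i → i < K → a i ∣ suc e
  a∣D i i<K = subst (a i ∣_) L≡D (∣-lcmFirst a K i i<K)
  p-mono : ∀ n y → frobeniusBound a K ≤ y → pA a K n ≤ pA a K (n + y)
  p-mono n y bound≤y = pA-≤-representable a a-pos K
    (representable-≥ K a a-pos y (subst (_∣ y) (sym gcd≡1) (1∣ y)) bound≤y) n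
  X₀≤ : frobeniusBound a K ≤ K * (suc e * suc e)
  X₀≤ = subst (λ L → frobeniusBound a K ≤ K * (L * L)) L≡D (frobeniusBound-≤ K a a-pos)
  bounds : Sandwich (suc k) K (suc e) (window (suc e) (pA a K))
  bounds = sandwich-window-pA-suc a a-pos (s≤s z≤n) (suc k) (a∣D (suc k) ≤-refl)
    (sandwich-pA-cumulative a a-pos (s≤s z≤n) K a∣D (suc k) (n≤1+n (suc k)))
  hyp′ : 4 * m * boundProd (suc e) K < K * (d * d)
  hyp′ = subst (λ L → 4 * m * boundProd L K < K * (d * d)) L≡D hyp
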